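{- There exist $n,k\in\mathbb{N}$ with $k\le n$ such that for every $2$-coloring of the edges of $B_{n,k}$ there exists a set of vertices of $B_{n,k}$ whose induced subgraph is isomorphic to $B_{4,2}$ and all of whose edges receive the same color (an induced monochromatic $B_{4,2}$).
   Context: For $n\in\mathbb{N}$ write $[n]=\{1,\dots,n\}$, and for a set $X$ write $\binom{X}{k}$ for the set of $k$-element subsets of $X$. For $k\le n$, $B_{n,k}$ denotes the bipartite graph with left vertex set $[n]$, right vertex set $\binom{[n]}{k}$, and edge set $\{(x,X)\in[n]\times\binom{[n]}{k} : x\in X\}$. A subgraph $H=(V',E')$ of a graph $G=(V,E)$ with $V'\subseteq V$ is induced if $E'$ consists of all edges of $G$ with both endpoints in $V'$. A $2$-coloring of the edges is any map from the edge set to a $2$-element set of colors. -}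

module Defs where

open import Data.Nat using (ℕ)
open import Data.Fin using (Fin)
open import Data.Fin.Subset using (Subset; ∣_∣; _∈_)
open import Data.Bool using (Bool)
open import Data.Sum using (_⊎_; inj₁; inj₂)
open import Data.Product using (Σ; ∃; _×_; proj₁)
open import Data.Empty using (⊥)
open import Relation.Binary.PropositionalEquality using (_≡_)
open import Function.Bundles using (_⇔_)
open import Function.Definitions using (Injective)

KSubset : ℕ → ℕ → Set
KSubset n k = Σ (Subset n) (λ X → ∣ X ∣ ≡ k)

Vertex : ℕ → ℕ → Set
Vertex n k = Fin n ⊎ KSubset n k

Adj : {n k : ℕ} → Vertex n k → Vertex n k → Set
Adj (inj₁ x) (inj₂ X) = x ∈ proj₁ X
Adj (inj₂ X) (inj₁ x) = x ∈ proj₁ X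
Adj (inj₁ _) (inj₁ _) = ⊥
Adj (inj₂ _) (inj₂ _) = ⊥

Colouring : ℕ → ℕ → Set
Colouring n k = (x : Fin n) (X : KSubset n k) → x ∈ proj₁ X → Bool

colourOf : {n k : ℕ} → Colouring n k → (u v : Vertex n k) → Adj u v → Bool
colourOf c (inj₁ x) (inj₂ X) a = c x X a
colourOf c (inj₂ X) (inj₁ x) a = c x X a

IsInducedCopy : {n k : ℕ} → (Vertex 4 2 → Vertex n k) → Set
IsInducedCopy f = Injective _≡_ _≡_ f × (∀ u v → Adj u v ⇔ Adj (f u) (f v))

Monochromatic : {n k : ℕ} → Colouring n k → (Vertex 4 2 → Vertex n k) → Bool → Set
Monochromatic c f b = ∀ u v (a : Adj (f u) (f v)) → colourOf c (f u) (f v) a ≡ b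

-- Take k = 3. In a 3-set {x < y < z} two of the three edges have the same colour b, so some pair
-- of the three points is witnessed by a pattern (pos , b), pos being the position of the third
-- point relative to the pair. Applying Ramsey's theorem once for each of the six patterns, either
-- three points have no witnessed pair, which is impossible, or ten points h₀ < ... < h₉ have all
-- their pairs witnessed by one pattern, say the pair hᵢ < hⱼ by the 3-set {hᵢ , hⱼ , zᵢⱼ}. Choosing
-- four of them, a₀ < a₁ < a₂ < a₃, so that no zᵢⱼ is one of the aₖ, the map i ↦ aᵢ,
-- {i , j} ↦ {aᵢ , aⱼ , zᵢⱼ} is an induced copy of B_{4,2} all of whose edges have colour b.

module Submission where

open import Defs
open import Data.Bool as Bool using (Bool; true; false)
open import Data.Empty using (⊥-elim)
open import Data.Fin as Fin using (Fin; zero; suc; _<_; _<?_; toℕ; fromℕ<)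
open import Data.Fin.Patterns using (0F; 1F; 2F; 3F)
open import Data.Fin.Properties
  using (<⇒≢; <-trans; <-irrefl; <-asym; <-cmp; <-irrelevant; any?; ¬∀⟶∃¬; pigeonhole;
         toℕ<n; toℕ-fromℕ<; toℕ-injective)
open import Data.Fin.Subset using (Subset; ⁅_⁆; _∪_; ∣_∣; _∈_; _∉_; ⊥; inside; outside)
open import Data.Fin.Subset.Properties
  using (x∈⁅x⁆; x∈⁅y⁆⇒x≡y; ∣⁅x⁆∣≡1; x∈p∪q⁺; x∈p∪q⁻; ∪-identityˡ; ⊆-antisym)
open import Data.List as List using (List; []; _∷_; length; filter; allFin)
open import Data.List.Properties using (length-tabulate)
open import Data.List.Membership.Propositional using () renaming (_∈_ to _∈ᴸ_)
open import Data.List.Membership.Propositional.Properties using (∈-lookup)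
open import Data.List.Relation.Binary.Sublist.Propositional using (_⊆_; []; _∷_; _∷ʳ_; ⊆-refl; ⊆-trans; minimum)
open import Data.List.Relation.Binary.Sublist.Propositional.Properties using (All-resp-⊆; filter-⊆)
open import Data.List.Relation.Unary.All as All using (All; []; _∷_)
open import Data.List.Relation.Unary.All.Properties using (all-filter)
open import Data.List.Relation.Unary.AllPairs as AllPairs using (AllPairs; []; _∷_)
open import Data.List.Relation.Unary.AllPairs.Properties using (tabulate⁺-<)
open import Data.List.Relation.Unary.Any using (here; there)
open import Data.List.Relation.Unary.Linked using ([-]; _∷_)
open import Data.List.Relation.Unary.Linked.Properties using (Linked⇒AllPairs)
open import Data.Nat as ℕ using (ℕ; zero; suc; _+_; _≤_; _≤?_; z≤n; s≤s; NonZero)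
open import Data.Nat.Properties
  using (suc-injective; ≡-irrelevant; ≤-refl; ≤-trans; <-≤-trans; ≰⇒>; <⇒≤; m≤m+n; m≤n+m; n<1+n; +-suc;
         +-monoˡ-<; +-monoʳ-<; +-cancelˡ-<; +-cancelˡ-≡; module ≤-Reasoning)
open import Data.Product as Product using (Σ; ∃; ∃₂; _×_; _,_; proj₁; proj₂)
open import Data.Sum as Sum using (_⊎_; inj₁; inj₂; [_,_]′)
open import Data.Sum.Properties using (inj₁-injective; inj₂-injective)
open import Data.Vec as Vec using (Vec; []; _∷_; here; there)
open import Data.Vec.Properties.WithK using ([]=-irrelevant)
open import Data.Vec.Relation.Unary.All as VecAll using ([]; _∷_)
open import Data.Vec.Relation.Unary.All.Properties using (lookup⁻)
open import Function using (id; _∘_; case_of_)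
open import Function.Bundles using (_⇔_; mk⇔; Equivalence)
open import Function.Definitions using (Injective)
open import Level using (0ℓ)
open import Relation.Binary.Core using (Rel)
open import Relation.Binary.Definitions using (Decidable; DecidableEquality; tri<; tri≈; tri>)
open import Relation.Binary.PropositionalEquality using (_≡_; _≢_; refl; sym; cong; cong₂; trans; subst)
open import Relation.Nullary using (Dec; yes; no; ¬_; ¬?; contradiction)
open import Relation.Nullary.Decidable using (True; toWitness; map′; _×-dec_; decidable-stable)
open import Relation.Nullary.Irrelevant using (Irrelevant)
open import Relation.Unary using (Pred) renaming (Decidable to Decidable₁)

-- Ramsey's theorem for lists

Clique : {A : Set} → Rel A 0ℓ → ℕ → List A → Set
Clique R s xs = ∃ λ ys → ys ⊆ xs × s ≤ length ys × AllPairs R ys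

module _ {A : Set} {R : Rel A 0ℓ} where

  AllPairs-resp-⊆ : ∀ {xs ys} → ys ⊆ xs → AllPairs R xs → AllPairs R ys
  AllPairs-resp-⊆ []             []         = []
  AllPairs-resp-⊆ (_ ∷ʳ ys⊆xs)   (_ ∷ Rxs)  = AllPairs-resp-⊆ ys⊆xs Rxs
  AllPairs-resp-⊆ (refl ∷ ys⊆xs) (Rx ∷ Rxs) = All-resp-⊆ ys⊆xs Rx ∷ AllPairs-resp-⊆ ys⊆xs Rxs

  AllPairs-universal : (∀ x y → R x y) → ∀ xs → AllPairs R xs
  AllPairs-universal R-all []       = []
  AllPairs-universal R-all (x ∷ xs) = All.universal (R-all x) xs ∷ AllPairs-universal R-all xs

  Clique-weaken : ∀ {s xs ys} → ys ⊆ xs → Clique R s ys → Clique R s xs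
  Clique-weaken ys⊆xs (zs , zs⊆ys , long , Rzs) = zs , ⊆-trans zs⊆ys ys⊆xs , long , Rzs

  Clique-cons : ∀ {s x xs} {Q : Pred A 0ℓ} (Q? : Decidable₁ Q) → (∀ {y} → Q y → R x y) →
                Clique R s (filter Q? xs) → Clique R (suc s) (x ∷ xs)
  Clique-cons {xs = xs} Q? Q⇒Rx (ys , ys⊆ , long , Rys) =
    _ ∷ ys , refl ∷ ⊆-trans ys⊆ (filter-⊆ Q? xs) , s≤s long ,
    All.map Q⇒Rx (All-resp-⊆ ys⊆ (all-filter Q? xs)) ∷ Rys

length-filter+filter-∁ : ∀ {A : Set} {Q : Pred A 0ℓ} (Q? : Decidable₁ Q) xs →
                         length (filter Q? xs) + length (filter (¬? ∘ Q?) xs) ≡ length xs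
length-filter+filter-∁ Q? []       = refl
length-filter+filter-∁ Q? (x ∷ xs) with Q? x
... | yes _ = cong suc (length-filter+filter-∁ Q? xs)
... | no  _ = trans (+-suc _ _) (cong suc (length-filter+filter-∁ Q? xs))

ramseyBound : ℕ → ℕ → ℕ
ramseyBound zero    t       = 0
ramseyBound (suc s) zero    = 0
ramseyBound (suc s) (suc t) = suc (ramseyBound s (suc t) + ramseyBound (suc s) t)

t≤ramseyBound : ∀ s t → .{{NonZero s}} → t ≤ ramseyBound s t
t≤ramseyBound (suc s) zero    = z≤n
t≤ramseyBound (suc s) (suc t) = s≤s (≤-trans (t≤ramseyBound (suc s) t) (m≤n+m _ _))

module _ {A : Set} {P : Rel A 0ℓ} (P? : Decidable P) where

  ramsey : ∀ s t (xs : List A) → ramseyBound s t ≤ length xs →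
           Clique P s xs ⊎ Clique (λ x y → ¬ P x y) t xs
  ramsey zero    t       xs _ = inj₁ ([] , minimum xs , z≤n , [])
  ramsey (suc s) zero    xs _ = inj₂ ([] , minimum xs , z≤n , [])
  ramsey (suc s) (suc t) (x ∷ xs) (s≤s bound)
    with ramseyBound s (suc t) ≤? length (filter (P? x) xs)
  ... | yes enough =
    Sum.map (Clique-cons (P? x) id) (Clique-weaken (x ∷ʳ filter-⊆ (P? x) xs))
            (ramsey s (suc t) (filter (P? x) xs) enough)
  ... | no few =
    Sum.map (Clique-weaken (x ∷ʳ filter-⊆ (¬? ∘ P? x) xs)) (Clique-cons (¬? ∘ P? x) id)
            (ramsey (suc s) t (filter (¬? ∘ P? x) xs) (<⇒≤ (+-cancelˡ-< _ _ _ rest)))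
    where
    open ≤-Reasoning
    rest : length (filter (P? x) xs) + ramseyBound (suc s) t
           ℕ.< length (filter (P? x) xs) + length (filter (¬? ∘ P? x) xs)
    rest = begin-strict
      length (filter (P? x) xs) + ramseyBound (suc s) t           <⟨ +-monoˡ-< _ (≰⇒> few) ⟩
      ramseyBound s (suc t) + ramseyBound (suc s) t               ≤⟨ bound ⟩
      length xs                                                   ≡⟨ length-filter+filter-∁ (P? x) xs ⟨
      length (filter (P? x) xs) + length (filter (¬? ∘ P? x) xs) ∎

iteratedBound : {I : Set} → ℕ → List I → ℕ → ℕ
iteratedBound s []       t = t
iteratedBound s (_ ∷ is) t = ramseyBound s (iteratedBound s is t)

t≤iteratedBound : ∀ {I : Set} s (is : List I) t → .{{NonZero s}} → t ≤ iteratedBound s is t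
t≤iteratedBound s []       t = ≤-refl
t≤iteratedBound s (_ ∷ is) t = ≤-trans (t≤iteratedBound s is t) (t≤ramseyBound s _)

module _ {A I : Set} {P : I → Rel A 0ℓ} (P? : ∀ i → Decidable (P i)) (s : ℕ) where

  iteratedRamsey : ∀ is t (xs : List A) → iteratedBound s is t ≤ length xs →
                   (∃ λ i → Clique (P i) s xs) ⊎ Clique (λ x y → All (λ i → ¬ P i x y) is) t xs
  iteratedRamsey []       t xs long  = inj₂ (xs , ⊆-refl , long , AllPairs-universal (λ _ _ → []) xs)
  iteratedRamsey (i ∷ is) t xs bound with ramsey (P? i) s _ xs bound
  ... | inj₁ clique = inj₁ (i , clique)
  ... | inj₂ (ys , ys⊆xs , long , ¬Pi) =
    Sum.map (Product.map₂ (Clique-weaken ys⊆xs)) extend (iteratedRamsey is t ys long)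
    where
    extend : Clique (λ x y → All (λ i → ¬ P i x y) is) t ys →
             Clique (λ x y → All (λ i → ¬ P i x y) (i ∷ is)) t xs
    extend (zs , zs⊆ys , long′ , ¬Pis) =
      zs , ⊆-trans zs⊆ys ys⊆xs , long′ ,
      AllPairs.zipWith (λ (¬Pi , ¬Pis) → ¬Pi ∷ ¬Pis) (AllPairs-resp-⊆ zs⊆ys ¬Pi , ¬Pis)

AllPairs-lookup : ∀ {A : Set} {R : Rel A 0ℓ} {xs} → AllPairs R xs →
                  ∀ {i j} → i < j → R (List.lookup xs i) (List.lookup xs j)
AllPairs-lookup (Rx ∷ _)   {zero}  {suc j} _           = All.lookup Rx (∈-lookup j)
AllPairs-lookup (_  ∷ Rxs) {suc i} {suc j} (ℕ.s<s i<j) = AllPairs-lookup Rxs i<j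

module _ {m m′} {f : Fin m → Fin m′} (f-increasing : ∀ {i j} → i < j → f i < f j) where

  increasing⇒injective : Injective _≡_ _≡_ f
  increasing⇒injective {i} {j} fi≡fj with <-cmp i j
  ... | tri< i<j _ _ = contradiction fi≡fj (<⇒≢ (f-increasing i<j))
  ... | tri≈ _ i≡j _ = i≡j
  ... | tri> _ _ j<i = contradiction (sym fi≡fj) (<⇒≢ (f-increasing j<i))

  increasing⇒reflects : ∀ {i j} → f i < f j → i < j
  increasing⇒reflects {i} {j} fi<fj with <-cmp i j
  ... | tri< i<j _ _  = i<j
  ... | tri≈ _ refl _ = contradiction fi<fj (<-irrefl refl)
  ... | tri> _ _ j<i  = contradiction fi<fj (<-asym (f-increasing j<i))

module _ {A : Set} (_≟_ : DecidableEquality A) where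

  avoid : ∀ {f} (v : Fin (suc f) → A) → Injective _≡_ _≡_ v → (zs : Vec A f) →
          ∃ λ i → VecAll.All (_≢ v i) zs
  avoid {f} v v-injective zs with any? (λ i → VecAll.all? (λ z → ¬? (z ≟ v i)) zs)
  ... | yes missed  = missed
  ... | no  ¬missed =
    let (i , j , i<j , same-hit) = pigeonhole (n<1+n f) (proj₁ ∘ hit)
        vi≡vj = trans (sym (proj₂ (hit i))) (trans (cong (Vec.lookup zs) same-hit) (proj₂ (hit j)))
    in contradiction (v-injective vi≡vj) (<⇒≢ i<j)
    where
    hit : ∀ i → ∃ λ k → Vec.lookup zs k ≡ v i
    hit i = Product.map₂ (decidable-stable (_ ≟ _))
      (¬∀⟶∃¬ f _ (λ k → ¬? (Vec.lookup zs k ≟ v i)) (¬missed ∘ (i ,_) ∘ lookup⁻))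

  avoid-within : ∀ {m} (h : Fin m → A) → Injective _≡_ _≡_ h → ∀ lo {f} (zs : Vec A f) → lo + suc f ≤ m →
                 ∃ λ k → lo ≤ toℕ k × toℕ k ℕ.< lo + suc f × VecAll.All (_≢ h k) zs
  avoid-within {m} h h-injective lo {f} zs fits =
    let (i , missed) = avoid (h ∘ slot) (slot-injective ∘ h-injective) zs in
    slot i , subst (lo ≤_) (sym (toℕ-slot i)) (m≤m+n lo _) ,
    subst (ℕ._< lo + suc f) (sym (toℕ-slot i)) (within i) , missed
    where
    within : ∀ i → lo + toℕ i ℕ.< lo + suc f
    within i = +-monoʳ-< lo (toℕ<n i)
    slot : Fin (suc f) → Fin m
    slot i = fromℕ< (<-≤-trans (within i) fits)
    toℕ-slot : ∀ i → toℕ (slot i) ≡ lo + toℕ i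
    toℕ-slot i = toℕ-fromℕ< _
    slot-injective : Injective _≡_ _≡_ slot
    slot-injective {i} {j} eq =
      toℕ-injective (+-cancelˡ-≡ lo _ _ (trans (sym (toℕ-slot i)) (trans (cong toℕ eq) (toℕ-slot j))))

Fin4-triples : (P : Fin 4 → Fin 4 → Fin 4 → Set) → P 0F 1F 2F → P 0F 1F 3F → P 0F 2F 3F → P 1F 2F 3F →
               ∀ u v w → u < v → v < w → P u v w
Fin4-triples _ p012 _ _ _ 0F 1F 2F _ _ = p012
Fin4-triples _ _ p013 _ _ 0F 1F 3F _ _ = p013
Fin4-triples _ _ _ p023 _ 0F 2F 3F _ _ = p023
Fin4-triples _ _ _ _ p123 1F 2F 3F _ _ = p123
Fin4-triples _ _ _ _ _ _             0F                  _  ()             _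
Fin4-triples _ _ _ _ _ _             _                   0F _              ()
Fin4-triples _ _ _ _ _ _             (suc _)             1F _              (s≤s ())
Fin4-triples _ _ _ _ _ (suc _)       1F                  _  (s≤s ())       _
Fin4-triples _ _ _ _ _ _             (suc (suc _))       2F _              (s≤s (s≤s ()))
Fin4-triples _ _ _ _ _ (suc (suc _)) 2F                  _  (s≤s (s≤s ())) _
Fin4-triples _ _ _ _ _ _             (suc (suc (suc _))) 3F _              (s≤s (s≤s (s≤s ())))

∣p∣≡0⇒p≡⊥ : ∀ {n} (p : Subset n) → ∣ p ∣ ≡ 0 → p ≡ ⊥
∣p∣≡0⇒p≡⊥ []            _     = refl
∣p∣≡0⇒p≡⊥ (outside ∷ p) ∣p∣≡0 = cong (outside ∷_) (∣p∣≡0⇒p≡⊥ p ∣p∣≡0)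

∣p∣≡1⇒p≡⁅x⁆ : ∀ {n} (p : Subset n) → ∣ p ∣ ≡ 1 → ∃ λ x → p ≡ ⁅ x ⁆
∣p∣≡1⇒p≡⁅x⁆ (outside ∷ p) ∣p∣≡1 with ∣p∣≡1⇒p≡⁅x⁆ p ∣p∣≡1
... | x , refl = suc x , refl
∣p∣≡1⇒p≡⁅x⁆ (inside ∷ p) ∣p∣≡1 = zero , cong (inside ∷_) (∣p∣≡0⇒p≡⊥ p (suc-injective ∣p∣≡1))

∣p∣≡2⇒p≡⁅x⁆∪⁅y⁆ : ∀ {n} (p : Subset n) → ∣ p ∣ ≡ 2 → ∃₂ λ x y → x < y × p ≡ ⁅ x ⁆ ∪ ⁅ y ⁆
∣p∣≡2⇒p≡⁅x⁆∪⁅y⁆ (outside ∷ p) ∣p∣≡2 with ∣p∣≡2⇒p≡⁅x⁆∪⁅y⁆ p ∣p∣≡2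
... | x , y , x<y , refl = suc x , suc y , ℕ.s<s x<y , refl
∣p∣≡2⇒p≡⁅x⁆∪⁅y⁆ (inside ∷ p) ∣p∣≡2 with ∣p∣≡1⇒p≡⁅x⁆ p (suc-injective ∣p∣≡2)
... | y , refl = zero , suc y , ℕ.z<s , cong (inside ∷_) (sym (∪-identityˡ _))

∣⁅x⁆∪p∣≡1+∣p∣ : ∀ {n} (x : Fin n) (p : Subset n) → x ∉ p → ∣ ⁅ x ⁆ ∪ p ∣ ≡ suc ∣ p ∣
∣⁅x⁆∪p∣≡1+∣p∣ zero    (outside ∷ p) _   = cong suc (cong ∣_∣ (∪-identityˡ p))
∣⁅x⁆∪p∣≡1+∣p∣ zero    (inside  ∷ p) x∉p = contradiction here x∉p
∣⁅x⁆∪p∣≡1+∣p∣ (suc x) (outside ∷ p) x∉p = ∣⁅x⁆∪p∣≡1+∣p∣ x p (x∉p ∘ there)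
∣⁅x⁆∪p∣≡1+∣p∣ (suc x) (inside  ∷ p) x∉p = cong suc (∣⁅x⁆∪p∣≡1+∣p∣ x p (x∉p ∘ there))

KSubset-≡ : ∀ {n k} {X Y : KSubset n k} → proj₁ X ≡ proj₁ Y → X ≡ Y
KSubset-≡ {X = p , ∣p∣≡k} {.p , ∣p∣≡k′} refl = cong (p ,_) (≡-irrelevant ∣p∣≡k ∣p∣≡k′)

pair-of-2-subset : ∀ {n} (X : KSubset n 2) → ∃₂ λ x y → x < y × ∀ w → w ∈ proj₁ X ⇔ (w ≡ x ⊎ w ≡ y)
pair-of-2-subset (p , ∣p∣≡2) with ∣p∣≡2⇒p≡⁅x⁆∪⁅y⁆ p ∣p∣≡2
... | x , y , x<y , refl = x , y , x<y , λ w →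
  mk⇔ (Sum.map (x∈⁅y⁆⇒x≡y x) (x∈⁅y⁆⇒x≡y y) ∘ x∈p∪q⁻ _ _)
      (x∈p∪q⁺ ∘ Sum.map (λ { refl → x∈⁅x⁆ x }) (λ { refl → x∈⁅x⁆ y }))

module _ {n} {x y z : Fin n} (x<y : x < y) (y<z : y < z) where

  triple : KSubset n 3
  triple = ⁅ x ⁆ ∪ (⁅ y ⁆ ∪ ⁅ z ⁆) ,
    trans (∣⁅x⁆∪p∣≡1+∣p∣ x _ x∉) (cong suc (trans (∣⁅x⁆∪p∣≡1+∣p∣ y _ y∉) (cong suc (∣⁅x⁆∣≡1 z))))
    where
    y∉ : y ∉ ⁅ z ⁆
    y∉ = <⇒≢ y<z ∘ x∈⁅y⁆⇒x≡y z
    x∉ : x ∉ ⁅ y ⁆ ∪ ⁅ z ⁆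
    x∉ = Sum.[ <⇒≢ x<y ∘ x∈⁅y⁆⇒x≡y y , <⇒≢ (<-trans x<y y<z) ∘ x∈⁅y⁆⇒x≡y z ] ∘ x∈p∪q⁻ _ _

  x∈triple : x ∈ proj₁ triple
  x∈triple = x∈p∪q⁺ (inj₁ (x∈⁅x⁆ x))

  y∈triple : y ∈ proj₁ triple
  y∈triple = x∈p∪q⁺ (inj₂ (x∈p∪q⁺ (inj₁ (x∈⁅x⁆ y))))

  z∈triple : z ∈ proj₁ triple
  z∈triple = x∈p∪q⁺ (inj₂ (x∈p∪q⁺ (inj₂ (x∈⁅x⁆ z))))

  ∈-triple⁻ : ∀ {w} → w ∈ proj₁ triple → w ≡ x ⊎ w ≡ y ⊎ w ≡ z
  ∈-triple⁻ = Sum.map (x∈⁅y⁆⇒x≡y x) (Sum.map (x∈⁅y⁆⇒x≡y y) (x∈⁅y⁆⇒x≡y z) ∘ x∈p∪q⁻ _ _) ∘ x∈p∪q⁻ _ _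

ColouredAt : ∀ {n k} → Colouring n k → Bool → Fin n → KSubset n k → Set
ColouredAt c b x X = (x∈X : x ∈ proj₁ X) → c x X x∈X ≡ b

colour-irrelevant : ∀ {n k} (c : Colouring n k) {x X} (x∈X : x ∈ proj₁ X) → ColouredAt c (c x X x∈X) x X
colour-irrelevant c x∈X x∈X′ = cong (c _ _) ([]=-irrelevant x∈X′ x∈X)

MonochromaticInducedCopy : ∀ {n k} → Colouring n k → Set
MonochromaticInducedCopy {n} {k} c =
  Σ (Vertex 4 2 → Vertex n k) λ f → IsInducedCopy f × Σ Bool λ b → Monochromatic c f b

-- The left vertex i of B_{4,2} goes to point i, the right vertex {u , v} to block u<v.
record Frame {n k} (c : Colouring n k) (b : Bool) : Set where
  field
    point           : Fin 4 → Fin n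
    point-injective : Injective _≡_ _≡_ point
    block           : ∀ {u v} → u < v → KSubset n k
    point∈block     : ∀ {u v} (u<v : u < v) w → point w ∈ proj₁ (block u<v) ⇔ (w ≡ u ⊎ w ≡ v)
    block-coloured  : ∀ {u v} (u<v : u < v) →
                      ColouredAt c b (point u) (block u<v) × ColouredAt c b (point v) (block u<v)

module _ {n k} {c : Colouring n k} {b : Bool} (F : Frame c b) where
  open Frame F
  open Equivalence

  image : KSubset 4 2 → KSubset n k
  image X = let (_ , _ , u<v , _) = pair-of-2-subset X in block u<v

  ∈⇔point∈image : ∀ i X → i ∈ proj₁ X ⇔ point i ∈ proj₁ (image X)
  ∈⇔point∈image i X = let (_ , _ , u<v , X⇔) = pair-of-2-subset X in
    mk⇔ (from (point∈block u<v i) ∘ to (X⇔ i)) (from (X⇔ i) ∘ to (point∈block u<v i))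

  image-coloured : ∀ i X → ColouredAt c b (point i) (image X)
  image-coloured i X i∈ with pair-of-2-subset X
  ... | _ , _ , u<v , _ with to (point∈block u<v i) i∈
  ...   | inj₁ refl = proj₁ (block-coloured u<v) i∈
  ...   | inj₂ refl = proj₂ (block-coloured u<v) i∈

  image-injective : Injective _≡_ _≡_ image
  image-injective eq = KSubset-≡ (⊆-antisym (⊆-via eq) (⊆-via (sym eq)))
    where
    ⊆-via : ∀ {X Y} → image X ≡ image Y → ∀ {i} → i ∈ proj₁ X → i ∈ proj₁ Y
    ⊆-via {X} {Y} eq {i} =
      from (∈⇔point∈image i Y) ∘ subst (λ Z → point i ∈ proj₁ Z) eq ∘ to (∈⇔point∈image i X)

  Frame⇒monochromaticInducedCopy : MonochromaticInducedCopy c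
  Frame⇒monochromaticInducedCopy = embed , (embed-injective , embed-adj) , b , embed-monochromatic
    where
    embed : Vertex 4 2 → Vertex n k
    embed = Sum.map point image

    embed-injective : Injective _≡_ _≡_ embed
    embed-injective {inj₁ _} {inj₁ _} eq = cong inj₁ (point-injective (inj₁-injective eq))
    embed-injective {inj₂ _} {inj₂ _} eq = cong inj₂ (image-injective (inj₂-injective eq))

    embed-adj : ∀ u v → Adj u v ⇔ Adj (embed u) (embed v)
    embed-adj (inj₁ i) (inj₂ X) = ∈⇔point∈image i X
    embed-adj (inj₂ X) (inj₁ i) = ∈⇔point∈image i X
    embed-adj (inj₁ _) (inj₁ _) = mk⇔ id id
    embed-adj (inj₂ _) (inj₂ _) = mk⇔ id id

    embed-monochromatic : Monochromatic c embed b
    embed-monochromatic (inj₁ i) (inj₂ X) = image-coloured i X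
    embed-monochromatic (inj₂ X) (inj₁ i) = image-coloured i X

-- Witnessed pairs

data Position : Set where
  after between before : Position

Placed : ∀ {m} → Position → Fin m → Fin m → Fin m → Set
Placed after   x y z = y < z
Placed between x y z = x < z × z < y
Placed before  x y z = z < x

placed? : ∀ {m} pos (x y z : Fin m) → Dec (Placed pos x y z)
placed? after   x y z = y <? z
placed? between x y z = (x <? z) ×-dec (z <? y)
placed? before  x y z = z <? x

placed-irrelevant : ∀ {m} pos {x y z : Fin m} → Irrelevant (Placed pos x y z)
placed-irrelevant after                     = <-irrelevant
placed-irrelevant between (p , q) (p′ , q′) = cong₂ _,_ (<-irrelevant p p′) (<-irrelevant q q′)
placed-irrelevant before                    = <-irrelevant

Placed-reflect : ∀ {m m′} {f : Fin m → Fin m′} → (∀ {i j} → i < j → f i < f j) →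
                 ∀ pos {i j k} → Placed pos (f i) (f j) (f k) → Placed pos i j k
Placed-reflect f-increasing after   = increasing⇒reflects f-increasing
Placed-reflect f-increasing between = Product.map reflects reflects
  where reflects = increasing⇒reflects f-increasing
Placed-reflect f-increasing before  = increasing⇒reflects f-increasing

-- P applied, for x < y < z, to the pair whose third point lies at pos and to that third point.
Split : ∀ {A : Set} → Position → (A → A → A → Set) → A → A → A → Set
Split after   P x y z = P x y z
Split between P x y z = P x z y
Split before  P x y z = P y z x

Split⇒Placed : ∀ {k} pos {P : Fin k → Fin k → Fin k → Set} → (∀ x y z → x < y → y < z → Split pos P x y z) →
               ∀ {u v w} → u < v → Placed pos u v w → P u v w
Split⇒Placed after   split {u} {v} {w} u<v v<w         = split u v w u<v v<w
Split⇒Placed between split {u} {v} {w} _   (u<w , w<v) = split u w v u<w w<v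
Split⇒Placed before  split {u} {v} {w} u<v w<u         = split w u v w<u u<v

triangle : ∀ {n} pos {x y z : Fin n} → x < y → Placed pos x y z → KSubset n 3
triangle after   x<y y<z         = triple x<y y<z
triangle between _   (x<z , z<y) = triple x<z z<y
triangle before  x<y z<x         = triple z<x x<y

module _ {n} {x y z : Fin n} where

  x∈triangle : ∀ pos (x<y : x < y) (pl : Placed pos x y z) → x ∈ proj₁ (triangle pos x<y pl)
  x∈triangle after   x<y y<z         = x∈triple x<y y<z
  x∈triangle between _   (x<z , z<y) = x∈triple x<z z<y
  x∈triangle before  x<y z<x         = y∈triple z<x x<y

  y∈triangle : ∀ pos (x<y : x < y) (pl : Placed pos x y z) → y ∈ proj₁ (triangle pos x<y pl)
  y∈triangle after   x<y y<z         = y∈triple x<y y<z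
  y∈triangle between _   (x<z , z<y) = z∈triple x<z z<y
  y∈triangle before  x<y z<x         = z∈triple z<x x<y

  ∈-triangle⁻ : ∀ pos (x<y : x < y) (pl : Placed pos x y z) {w} →
                w ∈ proj₁ (triangle pos x<y pl) → w ≡ x ⊎ w ≡ y ⊎ w ≡ z
  ∈-triangle⁻ after   x<y y<z         = ∈-triple⁻ x<y y<z
  ∈-triangle⁻ between _   (x<z , z<y) = Sum.map₂ Sum.swap ∘ ∈-triple⁻ x<z z<y
  ∈-triangle⁻ before  x<y z<x         = Sum.[ inj₂ ∘ inj₂ , Sum.map₂ inj₁ ] ∘ ∈-triple⁻ z<x x<y

Pattern : Set
Pattern = Position × Bool

patterns : List Pattern
patterns = (after , false) ∷ (after , true) ∷ (between , false) ∷ (between , true) ∷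
           (before , false) ∷ (before , true) ∷ []

∈-patterns : ∀ p → p ∈ᴸ patterns
∈-patterns (after   , false) = here refl
∈-patterns (after   , true)  = there (here refl)
∈-patterns (between , false) = there (there (here refl))
∈-patterns (between , true)  = there (there (there (here refl)))
∈-patterns (before  , false) = there (there (there (there (here refl))))
∈-patterns (before  , true)  = there (there (there (there (there (here refl)))))

WitnessedBy : ∀ {n} → Colouring n 3 → Pattern → (x y z : Fin n) → Set
WitnessedBy c (pos , b) x y z = Σ (x < y) λ x<y → Σ (Placed pos x y z) λ pl →
  ColouredAt c b x (triangle pos x<y pl) × ColouredAt c b y (triangle pos x<y pl)

Witnessed : ∀ {n} → Colouring n 3 → Pattern → Fin n → Fin n → Set
Witnessed c p x y = ∃ (WitnessedBy c p x y)

dec-Σ : ∀ {A : Set} {B : A → Set} → Dec A → Irrelevant A → (∀ a → Dec (B a)) → Dec (Σ A B)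
dec-Σ         (no ¬a) _   _  = no (¬a ∘ proj₁)
dec-Σ {B = B} (yes a) irr B? = map′ (a ,_) (λ (a′ , b) → subst B (irr a′ a) b) (B? a)

colouredAt? : ∀ {n k} (c : Colouring n k) b {x X} → x ∈ proj₁ X → Dec (ColouredAt c b x X)
colouredAt? c b x∈X =
  map′ (λ eq x∈X′ → trans (colour-irrelevant c x∈X x∈X′) eq) (λ col → col x∈X) (c _ _ x∈X Bool.≟ b)

witnessed? : ∀ {n} (c : Colouring n 3) p (x y : Fin n) → Dec (Witnessed c p x y)
witnessed? c (pos , b) x y =
  map′ (λ (z , x<y , w) → x<y , z , w) (λ (x<y , z , w) → z , x<y , w)
    (dec-Σ (x <? y) <-irrelevant λ x<y → any? λ z → dec-Σ (placed? pos x y z) (placed-irrelevant pos) λ pl →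
       colouredAt? c b (x∈triangle pos x<y pl) ×-dec colouredAt? c b (y∈triangle pos x<y pl))

two-of-three-equal : ∀ (a b c : Bool) → a ≡ b ⊎ a ≡ c ⊎ b ≡ c
two-of-three-equal false false _     = inj₁ refl
two-of-three-equal true  true  _     = inj₁ refl
two-of-three-equal false true  false = inj₂ (inj₁ refl)
two-of-three-equal true  false true  = inj₂ (inj₁ refl)
two-of-three-equal false true  true  = inj₂ (inj₂ refl)
two-of-three-equal true  false false = inj₂ (inj₂ refl)

every-triple-witnessed : ∀ {n} (c : Colouring n 3) {x y z : Fin n} → x < y → y < z →
                         ∃ λ p → Witnessed c p x y ⊎ Witnessed c p x z ⊎ Witnessed c p y z
every-triple-witnessed c {x} {y} {z} x<y y<z =
  case two-of-three-equal (c x T (x∈triple x<y y<z)) (c y T (y∈triple x<y y<z)) (c z T (z∈triple x<y y<z)) of λ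
    { (inj₁ x≡y)        → (after , _) , inj₁ (z , x<y , y<z , recolour x≡y , colour-irrelevant c _)
    ; (inj₂ (inj₁ x≡z)) → (between , _) ,
                          inj₂ (inj₁ (y , <-trans x<y y<z , (x<y , y<z) , recolour x≡z , colour-irrelevant c _))
    ; (inj₂ (inj₂ y≡z)) → (before , _) , inj₂ (inj₂ (x , y<z , x<y , recolour y≡z , colour-irrelevant c _))
    }
  where
  T = triple x<y y<z
  recolour : ∀ {w} {w∈T : w ∈ proj₁ T} {b} → c w T w∈T ≡ b → ColouredAt c b w T
  recolour refl = colour-irrelevant c _

no-unwitnessed-triple : ∀ {n} (c : Colouring n 3) {xs : List (Fin n)} → 3 ≤ length xs → AllPairs _<_ xs →
                        ¬ AllPairs (λ x y → All (λ p → ¬ Witnessed c p x y) patterns) xs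
no-unwitnessed-triple c {[]}          ()
no-unwitnessed-triple c {_ ∷ []}      (s≤s ())
no-unwitnessed-triple c {_ ∷ _ ∷ []}  (s≤s (s≤s ()))
no-unwitnessed-triple c {_ ∷ _ ∷ _ ∷ _} _ ((x<y ∷ _) ∷ (y<z ∷ _) ∷ _) ((¬xy ∷ ¬xz ∷ _) ∷ (¬yz ∷ _) ∷ _)
  with every-triple-witnessed c x<y y<z
... | p , inj₁ xy        = All.lookup ¬xy (∈-patterns p) xy
... | p , inj₂ (inj₁ xz) = All.lookup ¬xz (∈-patterns p) xz
... | p , inj₂ (inj₂ yz) = All.lookup ¬yz (∈-patterns p) yz

-- Homogeneous sequences

corners : ∀ {m} → Fin m → Fin m → Fin m → Fin m → Fin 4 → Fin m
corners p q r s = List.lookup (p ∷ q ∷ r ∷ s ∷ [])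

module Homogeneous {n m} (c : Colouring n 3) (pos : Position) (b : Bool) (h : Fin m → Fin n)
                   (witnessed : ∀ {i j} → i < j → Witnessed c (pos , b) (h i) (h j)) where

  h-increasing : ∀ {i j} → i < j → h i < h j
  h-increasing = proj₁ ∘ proj₂ ∘ witnessed

  -- A junk value unless i < j.
  apex : Fin m → Fin m → Fin n
  apex i j with i <? j
  ... | yes i<j = proj₁ (witnessed i<j)
  ... | no  _   = h i

  apex-witnesses : ∀ {i j} → i < j → WitnessedBy c (pos , b) (h i) (h j) (apex i j)
  apex-witnesses {i} {j} i<j with i <? j
  ... | yes i<j′ = proj₂ (witnessed i<j′)
  ... | no  i≮j  = contradiction i<j i≮j

  Misses : Fin m → Fin m → Fin m → Set
  Misses i j k = apex i j ≢ h k

  pick : 10 ≤ m → ∀ lo {f} (zs : Vec (Fin n) f) → {True (lo + suc f ≤? 10)} →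
         ∃ λ k → lo ≤ toℕ k × toℕ k ℕ.< lo + suc f × VecAll.All (_≢ h k) zs
  pick long lo zs {fits} =
    avoid-within Fin._≟_ h (increasing⇒injective h-increasing) lo zs (≤-trans (toWitness fits) long)

  quadrupleFrame : ∀ {p q r s} → p < q → q < r → r < s → let a = corners p q r s in
                   (∀ x y z → x < y → y < z → Split pos (λ u v w → Misses (a u) (a v) (a w)) x y z) → Frame c b
  quadrupleFrame {p} {q} {r} {s} p<q q<r r<s split = record
    { point           = point
    ; point-injective = increasing⇒injective point-increasing
    ; block           = block
    ; point∈block     = point∈block
    ; block-coloured  = λ u<v → proj₂ (proj₂ (apex-witnesses (a-increasing u<v)))
    }
    where
    a : Fin 4 → Fin m
    a = corners p q r s

    a-increasing : ∀ {u v} → u < v → a u < a v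
    a-increasing = AllPairs-lookup (Linked⇒AllPairs {R = _<_} <-trans (p<q ∷ q<r ∷ r<s ∷ [-]))

    point : Fin 4 → Fin n
    point = h ∘ a

    point-increasing : ∀ {u v} → u < v → point u < point v
    point-increasing = h-increasing ∘ a-increasing

    block : ∀ {u v} → u < v → KSubset n 3
    block u<v = let (x<y , pl , _) = apex-witnesses (a-increasing u<v) in triangle pos x<y pl

    point∈block : ∀ {u v} (u<v : u < v) w → point w ∈ proj₁ (block u<v) ⇔ (w ≡ u ⊎ w ≡ v)
    point∈block {u} {v} u<v w = mk⇔ to from
      where
      x<y = proj₁ (apex-witnesses (a-increasing u<v))
      pl  = proj₁ (proj₂ (apex-witnesses (a-increasing u<v)))
      to : point w ∈ proj₁ (block u<v) → w ≡ u ⊎ w ≡ v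
      to w∈ with ∈-triangle⁻ pos x<y pl w∈
      ... | inj₁ w≡u           = inj₁ (increasing⇒injective point-increasing w≡u)
      ... | inj₂ (inj₁ w≡v)    = inj₂ (increasing⇒injective point-increasing w≡v)
      ... | inj₂ (inj₂ w≡apex) = contradiction (sym w≡apex)
        (Split⇒Placed pos split {w = w} u<v
          (Placed-reflect point-increasing pos (subst (Placed pos _ _) (sym w≡apex) pl)))
      from : w ≡ u ⊎ w ≡ v → point w ∈ proj₁ (block u<v)
      from (inj₁ refl) = x∈triangle pos x<y pl
      from (inj₂ refl) = y∈triangle pos x<y pl

module _ {n m} {c : Colouring n 3} {b : Bool} {h : Fin m → Fin n} (long : 10 ≤ m) where

  module _ (witnessed : ∀ {i j} → i < j → Witnessed c (after , b) (h i) (h j)) where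
    open Homogeneous c after b h witnessed

    after-frame : Frame c b
    after-frame =
      case pick long 0 [] of λ { (p , _ , p<1 , []) →
      case pick long 1 [] of λ { (q , 1≤q , q<2 , []) →
      case pick long 2 (apex p q ∷ []) of λ { (r , 2≤r , r<4 , pq≢r ∷ []) →
      case pick long 4 (apex p q ∷ apex p r ∷ apex q r ∷ []) of λ { (s , 4≤s , _ , pq≢s ∷ pr≢s ∷ qr≢s ∷ []) →
      quadrupleFrame (<-≤-trans p<1 1≤q) (<-≤-trans q<2 2≤r) (<-≤-trans r<4 4≤s)
        (Fin4-triples _ pq≢r pq≢s pr≢s qr≢s) }}}}

  module _ (witnessed : ∀ {i j} → i < j → Witnessed c (before , b) (h i) (h j)) where
    open Homogeneous c before b h witnessed

    before-frame : Frame c b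
    before-frame =
      case pick long 8 [] of λ { (r , 8≤r , r<9 , []) →
      case pick long 9 [] of λ { (s , 9≤s , _ , []) →
      case pick long 6 (apex r s ∷ []) of λ { (q , 6≤q , q<8 , rs≢q ∷ []) →
      case pick long 2 (apex q r ∷ apex q s ∷ apex r s ∷ []) of λ { (p , _ , p<6 , qr≢p ∷ qs≢p ∷ rs≢p ∷ []) →
      quadrupleFrame (<-≤-trans p<6 6≤q) (<-≤-trans q<8 8≤r) (<-≤-trans r<9 9≤s)
        (Fin4-triples _ qr≢p qs≢p rs≢p rs≢q) }}}}

  module _ (witnessed : ∀ {i j} → i < j → Witnessed c (between , b) (h i) (h j)) where
    open Homogeneous c between b h witnessed

    -- If apex p y′ is h t, it is not h y, and the corners p < y < y′ < s do instead of p < t < y′ < s.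
    between-frame : Frame c b
    between-frame =
      case pick long 0 [] of λ { (p , _ , p<1 , []) →
      case pick long 9 [] of λ { (s , 9≤s , _ , []) →
      case pick long 1 (apex p s ∷ []) of λ { (t , 1≤t , t<3 , ps≢t ∷ []) →
      case pick long 3 (apex p s ∷ []) of λ { (y , 3≤y , y<5 , ps≢y ∷ []) →
      case pick long 5 (apex p s ∷ apex t s ∷ apex y s ∷ []) of λ {
        (y′ , 5≤y′ , y′<9 , ps≢y′ ∷ ts≢y′ ∷ ys≢y′ ∷ []) →
      let p<t  = <-≤-trans p<1 1≤t
          t<y  = <-≤-trans t<3 3≤y
          y<y′ = <-≤-trans y<5 5≤y′
          y′<s = <-≤-trans y′<9 9≤s
      in case apex p y′ Fin.≟ h t of λ
        { (no py′≢t) →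
            quadrupleFrame p<t (<-trans t<y y<y′) y′<s (Fin4-triples _ py′≢t ps≢t ps≢y′ ts≢y′)
        ; (yes py′≡t) →
            quadrupleFrame (<-trans p<t t<y) y<y′ y′<s
              (Fin4-triples _ (<⇒≢ (h-increasing t<y) ∘ trans (sym py′≡t)) ps≢y ps≢y′ ys≢y′)
        } }}}}}

homogeneous⇒Frame : ∀ {n m} {c : Colouring n 3} ((pos , b) : Pattern) {h : Fin m → Fin n} → 10 ≤ m →
                    (∀ {i j} → i < j → Witnessed c (pos , b) (h i) (h j)) → Frame c b
homogeneous⇒Frame (after   , b) = after-frame
homogeneous⇒Frame (between , b) = between-frame
homogeneous⇒Frame (before  , b) = before-frame

-- n is kept abstract: Agda's built-in addition would evaluate the astronomically large bound as soon
-- as it had to be compared with anything but a syntactic copy of itself.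
monochromaticInducedCopy : ∀ {n} → iteratedBound 10 patterns 3 ≤ n →
                           (c : Colouring n 3) → MonochromaticInducedCopy c
monochromaticInducedCopy {n} large c =
  [ homogeneous , ⊥-elim ∘ unwitnessed ]′
    (iteratedRamsey (witnessed? c) 10 patterns 3 (allFin n)
                    (subst (iteratedBound 10 patterns 3 ≤_) (sym (length-tabulate id)) large))
  where
  homogeneous : (∃ λ p → Clique (Witnessed c p) 10 (allFin n)) → MonochromaticInducedCopy c
  homogeneous (p , ys , _ , long , ys-witnessed) =
    Frame⇒monochromaticInducedCopy (homogeneous⇒Frame p long (AllPairs-lookup ys-witnessed))

  unwitnessed : ¬ Clique (λ x y → All (λ p → ¬ Witnessed c p x y) patterns) 3 (allFin n)
  unwitnessed (ys , ys⊆ , long , ys-unwitnessed) =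
    no-unwitnessed-triple c long (AllPairs-resp-⊆ ys⊆ (tabulate⁺-< id)) ys-unwitnessed

theorem12 : Σ ℕ λ n → Σ ℕ λ k → k ≤ n × ((c : Colouring n k) → Σ (Vertex 4 2 → Vertex n k) λ f → IsInducedCopy f × Σ Bool λ b → Monochromatic c f b)
theorem12 = iteratedBound 10 patterns 3 , 3 , t≤iteratedBound 10 patterns 3 , monochromaticInducedCopy ≤-refl
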